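{- Let $i, D \in \mathbb{N}_0$, $A \in \mathbb{N}_+$, and $\kappa \in \mathbb{N}_0$. Let $(j, \Delta) = \mathrm{ds}(i, D, A, \kappa, 0)$. Then $j$ is a nearest integer solution to $i\frac{D}{A}$ and $\Delta = jA - iD$.
   Context: $\mathbb{N}_0$ denotes the set of non-negative integers and $\mathbb{N}_+$ the set of positive integers. Given $i, D \in \mathbb{N}_0$ and $A \in \mathbb{N}_+$, an integer $j \in \mathbb{N}_0$ is called a nearest integer solution to $i\frac{D}{A}$ if $j \in \arg\min_{k \in \mathbb{N}_0} \left| k - i\frac{D}{A} \right|$ (there may be up to two such $j$). For $x \in \mathbb{N}_0$, $x \bmod A \in \{0,\ldots,A-1\}$ is the remainder on division by $A$. The function $\mathrm{ds}(i, D, A, k_0, \Delta_-)$, with integer inputs $k_0$ and $\Delta_-$, returns a pair of integers $(j,\Delta)$ computed as follows. Set $\Delta_0 := (k_0 - i)A + i(A - D) + \Delta_-$. Case 1: if $\Delta_0 = 0$, return $(k_0, \Delta_0)$. Case 2: if $\Delta_0 > 0$, set $k_1 := k_0 - \lfloor \Delta_0 / A \rfloor$ and $\Delta_1 := \Delta_0 \bmod A$; if $|\Delta_1 - A| < |\Delta_1|$ return $(k_1 - 1, \Delta_1 - A)$, otherwise return $(k_1, \Delta_1)$. Case 3: if $\Delta_0 < 0$, set $k_1 := k_0 + \lfloor |\Delta_0| / A \rfloor$ and $\Delta_1 := -(|\Delta_0| \bmod A)$; if $|\Delta_1 + A| < |\Delta_1|$ return $(k_1 + 1, \Delta_1 +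 A)$, otherwise return $(k_1, \Delta_1)$. -}

module Defs where

open import Data.Nat as ℕ using (ℕ; NonZero; _/_; _%_)
open import Data.Integer as ℤ using (ℤ; +_; -_; ∣_∣; _<_; _>_)
open import Data.Rational as ℚ using (ℚ)
open import Data.Product using (_×_; _,_)
open import Relation.Nullary using (does)
open import Data.Bool using (if_then_else_)
open import Relation.Binary.PropositionalEquality using (_≡_)

NearestIntegerSolution : (i D A : ℕ) → .{{NonZero A}} → ℕ → Set
NearestIntegerSolution i D A j =
  ∀ (k : ℕ) → ℚ.∣ (+ j ℚ./ 1) ℚ.- (+ (i ℕ.* D) ℚ./ A) ∣
                ℚ.≤ ℚ.∣ (+ k ℚ./ 1) ℚ.- (+ (i ℕ.* D) ℚ./ A) ∣

ds : (i D A : ℕ) → .{{NonZero A}} → ℤ → ℤ → ℤ × ℤ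
ds i D A k₀ Δ₋ = go ((k₀ ℤ.- + i) ℤ.* + A ℤ.+ (+ i) ℤ.* ((+ A) ℤ.- (+ D)) ℤ.+ Δ₋)
  where
  go : ℤ → ℤ × ℤ
  go (+ 0) = k₀ , + 0
  go Δ₀@(ℤ.+[1+ _ ]) =
    let k₁ = k₀ ℤ.- + (∣ Δ₀ ∣ / A)
        Δ₁ = + (∣ Δ₀ ∣ % A)
    in if does (∣ Δ₁ ℤ.- + A ∣ ℕ.<? ∣ Δ₁ ∣)
         then (k₁ ℤ.- + 1 , Δ₁ ℤ.- + A)
         else (k₁ , Δ₁)
  go Δ₀@(ℤ.-[1+ _ ]) =
    let k₁ = k₀ ℤ.+ + (∣ Δ₀ ∣ / A)
        Δ₁ = - + (∣ Δ₀ ∣ % A)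
    in if does (∣ Δ₁ ℤ.+ + A ∣ ℕ.<? ∣ Δ₁ ∣)
         then (k₁ ℤ.+ + 1 , Δ₁ ℤ.+ + A)
         else (k₁ , Δ₁)

-- Write x = i·D. The first step of ds already produces the exact defect Δ₀ = κA − x of κ, and
-- every later step only trades multiples of A between j and Δ, so Δ = jA − x throughout.
-- Division with remainder leaves two candidates whose defects have absolute values summing to
-- A, and ds keeps the one with the smaller, so 2|Δ| ≤ A. Such a j is nearest: for k ≠ j,
-- A ≤ |j − k|·A ≤ |jA − x| + |kA − x|, hence |kA − x| ≥ A − |Δ| ≥ |Δ|; and j cannot be
-- negative, since then |Δ| ≥ A. Dividing by A turns this into the rational statement.
module Submission where

open import Defs
open import Data.Bool using (true; false; if_then_else_)
open import Data.Empty using (⊥-elim)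
open import Data.Integer as ℤ using (ℤ; +_; -[1+_]; +[1+_]; -_; _-_; ∣_∣)
import Data.Integer.Properties as ℤ
open import Data.Integer.Tactic.RingSolver using (solve-∀)
open import Data.Nat as ℕ using (ℕ; NonZero; suc; zero; _≤_; _<_; z≤n; s≤s; _%_; _/_)
import Data.Nat.Properties as ℕ
open import Data.Nat.DivMod using (m≡m%n+[m/n]*n; m%n<n)
open import Data.Product using (_×_; _,_; Σ; proj₁; proj₂)
open import Data.Rational as ℚ using ()
import Data.Rational.Properties as ℚ
open import Data.Rational.Unnormalised as ℚᵘ using (ℚᵘ; mkℚᵘ; ↥_; ↧_)
import Data.Rational.Unnormalised.Properties as ℚᵘ
open import Relation.Binary.PropositionalEquality
open import Relation.Nullary using (yes; no; does; ofʸ; ofⁿ)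

∣r-n∣+∣r∣≡n : ∀ {r n} → r < n → ∣ + r - + n ∣ ℕ.+ ∣ + r ∣ ≡ n
∣r-n∣+∣r∣≡n {r} {n} r<n = begin
  ∣ + r - + n ∣ ℕ.+ r  ≡⟨ cong (λ d → ∣ d ∣ ℕ.+ r) (ℤ.m-n≡m⊖n r n) ⟩
  ∣ r ℤ.⊖ n ∣ ℕ.+ r    ≡⟨ cong (ℕ._+ r) (ℤ.∣⊖∣-< r<n) ⟩
  n ℕ.∸ r ℕ.+ r        ≡⟨ ℕ.m∸n+n≡m (ℕ.<⇒≤ r<n) ⟩
  n                    ∎
  where open ≡-Reasoning

∣-r+n∣+∣-r∣≡n : ∀ {r n} → r < n → ∣ - + r ℤ.+ + n ∣ ℕ.+ ∣ - + r ∣ ≡ n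
∣-r+n∣+∣-r∣≡n {r} {n} r<n = begin
  ∣ - + r ℤ.+ + n ∣ ℕ.+ ∣ - + r ∣  ≡⟨ cong₂ (λ d e → ∣ d ∣ ℕ.+ e) (ℤ.-m+n≡n⊖m r n) (ℤ.∣-i∣≡∣i∣ (+ r)) ⟩
  ∣ n ℤ.⊖ r ∣ ℕ.+ r                ≡⟨ cong (ℕ._+ r) (cong ∣_∣ (ℤ.⊖-≥ (ℕ.<⇒≤ r<n))) ⟩
  n ℕ.∸ r ℕ.+ r                    ≡⟨ ℕ.m∸n+n≡m (ℕ.<⇒≤ r<n) ⟩
  n                                ∎
  where open ≡-Reasoning

+n≡+[n%d]+[n/d]*d : ∀ n d .{{_ : NonZero d}} → + n ≡ + (n % d) ℤ.+ + (n / d) ℤ.* + d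
+n≡+[n%d]+[n/d]*d n d = begin
  + n                                ≡⟨ cong +_ (m≡m%n+[m/n]*n n d) ⟩
  + (n % d ℕ.+ n / d ℕ.* d)          ≡⟨ ℤ.pos-+ (n % d) (n / d ℕ.* d) ⟩
  + (n % d) ℤ.+ + (n / d ℕ.* d)      ≡⟨ cong (ℤ._+_ (+ (n % d))) (ℤ.pos-* (n / d) d) ⟩
  + (n % d) ℤ.+ + (n / d) ℤ.* + d    ∎
  where open ≡-Reasoning

Defect : ℕ → ℕ → ℤ × ℤ → Set
Defect A x (j , Δ) = Δ ≡ j ℤ.* + A - + x

defect-+ : ∀ {A x j Δ Δ′} → Defect A x (j , Δ) → ∀ c → Δ′ ≡ Δ ℤ.+ c ℤ.* + A → Defect A x (j ℤ.+ c , Δ′)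
defect-+ {A} {x} {j} {Δ} {Δ′} Δ≡ c Δ′≡ = begin
  Δ′                              ≡⟨ Δ′≡ ⟩
  Δ ℤ.+ c ℤ.* + A                 ≡⟨ cong (λ d → d ℤ.+ c ℤ.* + A) Δ≡ ⟩
  j ℤ.* + A - + x ℤ.+ c ℤ.* + A   ≡⟨ regroup j c (+ A) (+ x) ⟩
  (j ℤ.+ c) ℤ.* + A - + x         ∎
  where
  open ≡-Reasoning
  regroup : ∀ j c A x → j ℤ.* A - x ℤ.+ c ℤ.* A ≡ (j ℤ.+ c) ℤ.* A - x
  regroup = solve-∀

Small : ℕ → ℤ → Set
Small A Δ = ∣ Δ ∣ ℕ.+ ∣ Δ ∣ ≤ A

small⇒nonNegative : ∀ {A x} j → 0 < A → Small A (j ℤ.* + A - + x) → Σ ℕ (λ n → j ≡ + n)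
small⇒nonNegative (+ n) _ _ = n , refl
small⇒nonNegative {A} {x} -[1+ t ] 0<A small = ⊥-elim (ℕ.<-irrefl refl (ℕ.<-≤-trans A<2∣Δ∣ small))
  where
  open ≡-Reasoning
  Δ = -[1+ t ] ℤ.* + A - + x
  negate : ∀ t A x → - t ℤ.* A - x ≡ - (t ℤ.* A ℤ.+ x)
  negate = solve-∀
  ∣Δ∣ : ∣ Δ ∣ ≡ suc t ℕ.* A ℕ.+ x
  ∣Δ∣ = begin
    ∣ Δ ∣                              ≡⟨ cong ∣_∣ (negate (+ suc t) (+ A) (+ x)) ⟩
    ∣ - (+ suc t ℤ.* + A ℤ.+ + x) ∣    ≡⟨ ℤ.∣-i∣≡∣i∣ (+ suc t ℤ.* + A ℤ.+ + x) ⟩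
    ∣ + suc t ℤ.* + A ℤ.+ + x ∣        ≡⟨ cong (λ d → ∣ d ℤ.+ + x ∣) (sym (ℤ.pos-* (suc t) A)) ⟩
    suc t ℕ.* A ℕ.+ x                  ∎
  A≤∣Δ∣ : A ≤ ∣ Δ ∣
  A≤∣Δ∣ = subst (A ≤_) (sym ∣Δ∣) (ℕ.≤-trans (ℕ.m≤m+n A (t ℕ.* A)) (ℕ.m≤m+n (suc t ℕ.* A) x))
  A<2∣Δ∣ : A < ∣ Δ ∣ ℕ.+ ∣ Δ ∣
  A<2∣Δ∣ = ℕ.<-≤-trans (ℕ.m<m+n A 0<A) (ℕ.+-mono-≤ A≤∣Δ∣ A≤∣Δ∣)

small⇒nearest : ∀ {A x} j → Small A (j ℤ.* + A - + x) →
                ∀ k → ∣ j ℤ.* + A - + x ∣ ≤ ∣ k ℤ.* + A - + x ∣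
small⇒nearest {A} {x} j small k with j ℤ.≟ k
... | yes refl = ℕ.≤-refl
... | no j≢k = ℕ.+-cancelˡ-≤ ∣Δ∣ ∣Δ∣ ∣kA-x∣ (begin
    ∣Δ∣ ℕ.+ ∣Δ∣                       ≤⟨ small ⟩
    A                                 ≤⟨ ℕ.m≤n*m A ∣ j - k ∣ {{ℕ.≢-nonZero ∣j-k∣≢0}} ⟩
    ∣ j - k ∣ ℕ.* A                   ≡⟨ sym (ℤ.abs-* (j - k) (+ A)) ⟩
    ∣ (j - k) ℤ.* + A ∣               ≡⟨ cong ∣_∣ (difference j k (+ A) (+ x)) ⟩
    ∣ (j ℤ.* + A - + x) - (k ℤ.* + A - + x) ∣  ≤⟨ ℤ.∣i-j∣≤∣i∣+∣j∣ (j ℤ.* + A - + x) _ ⟩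
    ∣Δ∣ ℕ.+ ∣kA-x∣                    ∎)
  where
  open ℕ.≤-Reasoning
  ∣Δ∣ = ∣ j ℤ.* + A - + x ∣
  ∣kA-x∣ = ∣ k ℤ.* + A - + x ∣
  difference : ∀ j k A x → (j - k) ℤ.* A ≡ (j ℤ.* A - x) - (k ℤ.* A - x)
  difference = solve-∀
  ∣j-k∣≢0 : ∣ j - k ∣ ≢ 0
  ∣j-k∣≢0 ∣j-k∣≡0 = j≢k (ℤ.i-j≡0⇒i≡j j k (ℤ.∣i∣≡0⇒i≡0 ∣j-k∣≡0))

≤ᵘ-of-numerators : ∀ {p q : ℚᵘ} → ↧ p ≡ ↧ q → ↥ p ℤ.≤ ↥ q → p ℚᵘ.≤ q
≤ᵘ-of-numerators {p@(mkℚᵘ _ _)} {q} ↧p≡↧q ↥p≤↥q =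
  ℚᵘ.*≤* (subst (λ d → ↥ p ℤ.* d ℤ.≤ ↥ q ℤ.* ↧ p) ↧p≡↧q (ℤ.*-monoʳ-≤-nonNeg (↧ p) ↥p≤↥q))

distᵘ : (k x : ℤ) (A : ℕ) .{{_ : NonZero A}} → ℚᵘ
distᵘ k x A = ℚᵘ.∣ (k ℚᵘ./ 1) ℚᵘ.- (x ℚᵘ./ A) ∣

toℚᵘ-dist : ∀ (k x : ℤ) a → ℚ.toℚᵘ (ℚ.∣ (k ℚ./ 1) ℚ.- (x ℚ./ suc a) ∣) ℚᵘ.≃ distᵘ k x (suc a)
toℚᵘ-dist k x a = ℚᵘ.≃-trans (ℚ.toℚᵘ-homo-∣-∣ _) (ℚᵘ.∣-∣-cong
  (ℚᵘ.≃-trans (ℚ.toℚᵘ-homo-+ (k ℚ./ 1) _) (ℚᵘ.+-cong (ℚ.toℚᵘ-fromℚᵘ (mkℚᵘ k 0))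
    (ℚᵘ.≃-trans (ℚ.toℚᵘ-homo‿- (x ℚ./ suc a)) (ℚᵘ.-‿cong (ℚ.toℚᵘ-fromℚᵘ (mkℚᵘ x a)))))))

↥distᵘ : ∀ (k x : ℤ) a → ↥ distᵘ k x (suc a) ≡ + ∣ k ℤ.* + suc a - x ∣
↥distᵘ k x a = cong (λ d → + ∣ k ℤ.* + suc a ℤ.+ d ∣) (ℤ.*-identityʳ (- x))

distᵘ-mono : ∀ {k l x : ℤ} a → ∣ k ℤ.* + suc a - x ∣ ≤ ∣ l ℤ.* + suc a - x ∣ →
             distᵘ k x (suc a) ℚᵘ.≤ distᵘ l x (suc a)
distᵘ-mono {k} {l} {x} a ≤-ints = ≤ᵘ-of-numerators refl
  (subst₂ ℤ._≤_ (sym (↥distᵘ k x a)) (sym (↥distᵘ l x a)) (ℤ.+≤+ ≤-ints))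

dist-mono : ∀ {k l x : ℤ} a → ∣ k ℤ.* + suc a - x ∣ ≤ ∣ l ℤ.* + suc a - x ∣ →
            ℚ.∣ (k ℚ./ 1) ℚ.- (x ℚ./ suc a) ∣ ℚ.≤ ℚ.∣ (l ℚ./ 1) ℚ.- (x ℚ./ suc a) ∣
dist-mono {k} {l} {x} a ≤-ints = ℚ.toℚᵘ-cancel-≤
  (ℚᵘ.≤-respˡ-≃ (ℚᵘ.≃-sym (toℚᵘ-dist k x a))
    (ℚᵘ.≤-respʳ-≃ (ℚᵘ.≃-sym (toℚᵘ-dist l x a)) (distᵘ-mono {k} {l} {x} a ≤-ints)))

Rounded : ℕ → ℕ → ℤ × ℤ → Set
Rounded A x (j , Δ) = Defect A x (j , Δ) × Small A Δ

rounded-choice : ∀ {A x} (X Y : ℤ × ℤ) → Defect A x X → Defect A x Y →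
                 ∣ proj₂ X ∣ ℕ.+ ∣ proj₂ Y ∣ ≡ A →
                 Rounded A x (if does (∣ proj₂ X ∣ ℕ.<? ∣ proj₂ Y ∣) then X else Y)
-- does (m <? n) computes to m <ᵇ n, so that is the term to split on.
rounded-choice X Y X-defect Y-defect sum
  with ∣ proj₂ X ∣ ℕ.<ᵇ ∣ proj₂ Y ∣ | ℕ.<ᵇ-reflects-< ∣ proj₂ X ∣ ∣ proj₂ Y ∣
... | true  | ofʸ X<Y = X-defect , subst (u ℕ.+ u ≤_) sum (ℕ.+-monoʳ-≤ u (ℕ.<⇒≤ X<Y))
  where u = ∣ proj₂ X ∣
... | false | ofⁿ X≮Y = Y-defect , subst (v ℕ.+ v ≤_) (trans (ℕ.+-comm v u) sum) (ℕ.+-monoʳ-≤ v (ℕ.≮⇒≥ X≮Y))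
  where u = ∣ proj₂ X ∣
        v = ∣ proj₂ Y ∣

ds-initial-defect : ∀ i D A κ {Δ} → (+ κ - + i) ℤ.* + A ℤ.+ + i ℤ.* (+ A - + D) ℤ.+ + 0 ≡ Δ →
                    Defect A (i ℕ.* D) (+ κ , Δ)
ds-initial-defect i D A κ refl =
  trans (expand (+ κ) (+ i) (+ A) (+ D)) (cong (λ d → + κ ℤ.* + A - d) (sym (ℤ.pos-* i D)))
  where
  expand : ∀ k i A D → (k - i) ℤ.* A ℤ.+ i ℤ.* (A - D) ℤ.+ + 0 ≡ k ℤ.* A - i ℤ.* D
  expand = solve-∀

ds-positive-rounded : ∀ {A x j n} .{{_ : NonZero A}} → Defect A x (j , + n) →
  let q = n / A
      r = + (n % A)
  in Rounded A x (if does (∣ r - + A ∣ ℕ.<? ∣ r ∣) then (j - + q - + 1 , r - + A) else (j - + q , r))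
ds-positive-rounded {A} {x} {j} {n} n-defect =
  rounded-choice {A} {x} _ _ r-A-defect r-defect (∣r-n∣+∣r∣≡n (m%n<n n A))
  where
  r = n % A
  q = n / A
  move : ∀ r q A → r ≡ (r ℤ.+ q ℤ.* A) ℤ.+ - q ℤ.* A
  move = solve-∀
  r-defect : Defect A x (j - + q , + r)
  r-defect = defect-+ {A} {x} {j} n-defect (- + q)
    (trans (move (+ r) (+ q) (+ A)) (cong (λ d → d ℤ.+ - + q ℤ.* + A) (sym (+n≡+[n%d]+[n/d]*d n A))))
  r-A-defect : Defect A x (j - + q - + 1 , + r - + A)
  r-A-defect = defect-+ {A} {x} {j - + q} r-defect ℤ.-1ℤ (cong (ℤ._+_ (+ r)) (sym (ℤ.-1*i≡-i (+ A))))

ds-negative-rounded : ∀ {A x j n} .{{_ : NonZero A}} → Defect A x (j , - + n) →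
  let q = n / A
      r = - + (n % A)
  in Rounded A x (if does (∣ r ℤ.+ + A ∣ ℕ.<? ∣ r ∣)
                    then (j ℤ.+ + q ℤ.+ + 1 , r ℤ.+ + A)
                    else (j ℤ.+ + q , r))
ds-negative-rounded {A} {x} {j} {n} n-defect =
  rounded-choice {A} {x} _ _ -r+A-defect r-defect (∣-r+n∣+∣-r∣≡n (m%n<n n A))
  where
  r = n % A
  q = n / A
  move : ∀ r q A → - r ≡ - (r ℤ.+ q ℤ.* A) ℤ.+ q ℤ.* A
  move = solve-∀
  r-defect : Defect A x (j ℤ.+ + q , - + r)
  r-defect = defect-+ {A} {x} {j} n-defect (+ q)
    (trans (move (+ r) (+ q) (+ A)) (cong (λ d → - d ℤ.+ + q ℤ.* + A) (sym (+n≡+[n%d]+[n/d]*d n A))))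
  -r+A-defect : Defect A x (j ℤ.+ + q ℤ.+ + 1 , - + r ℤ.+ + A)
  -r+A-defect = defect-+ {A} {x} {j ℤ.+ + q} r-defect (+ 1)
                  (cong (ℤ._+_ (- + r)) (sym (ℤ.*-identityˡ (+ A))))

small⇒nearestIntegerSolution : ∀ i D a j → Small (suc a) (j ℤ.* + suc a - + (i ℕ.* D)) →
                               Σ ℕ (λ n → (j ≡ + n) × NearestIntegerSolution i D (suc a) n)
small⇒nearestIntegerSolution i D a j small with small⇒nonNegative j (s≤s z≤n) small
... | n , refl = n , refl , λ k → dist-mono {+ n} {+ k} a (small⇒nearest (+ n) small (+ k))

rounded⇒nearest : ∀ i D a (p : ℤ × ℤ) → Rounded (suc a) (i ℕ.* D) p →
  Σ ℕ (λ n → (proj₁ p ≡ + n) × NearestIntegerSolution i D (suc a) n)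
  × (proj₂ p ≡ proj₁ p ℤ.* + suc a - + (i ℕ.* D))
rounded⇒nearest i D a (j , Δ) (Δ≡ , small) =
  small⇒nearestIntegerSolution i D a j (subst (Small (suc a)) Δ≡ small) , Δ≡

theorem3 : (i D A : ℕ) → .{{_ : NonZero A}} → (κ : ℕ) →
    let jΔ = ds i D A (+ κ) (+ 0)
        j = proj₁ jΔ
        Δ = proj₂ jΔ
    in Σ ℕ (λ n → (j ≡ + n) × NearestIntegerSolution i D A n)
       × (Δ ≡ j ℤ.* + A ℤ.- + (i ℕ.* D))
theorem3 i D zero κ = ⊥-elim (ℕ.≢-nonZero⁻¹ 0 refl)
theorem3 i D A@(suc a) κ with (+ κ ℤ.- + i) ℤ.* + A ℤ.+ + i ℤ.* (+ A ℤ.- + D) ℤ.+ + 0 in eq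
... | + 0      = rounded⇒nearest i D a _ (ds-initial-defect i D A κ eq , z≤n)
... | +[1+ m ] = rounded⇒nearest i D a _
                   (ds-positive-rounded {A} {i ℕ.* D} {+ κ} (ds-initial-defect i D A κ eq))
... | -[1+ m ] = rounded⇒nearest i D a _
                   (ds-negative-rounded {A} {i ℕ.* D} {+ κ} (ds-initial-defect i D A κ eq))
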